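{- Let $p\geq 5$ and $p'=p+2$ both be prime. Then for every integer $n\geq 0$ the numbers $pp'(2n+1)\pm 4\frac{p+1}{6}$ are positive, and $$p\Big[p'(2n+1)+4\tfrac{p+1}{6}\Big]+4\tfrac{p+1}{6}=p'\Big[p(2n+1)+4\tfrac{p+1}{6}\Big]-4\tfrac{p'-1}{6}>0,$$ $$p\Big[p'(2n+1)-4\tfrac{p+1}{6}\Big]-4\tfrac{p+1}{6}=p'\Big[p(2n+1)-4\tfrac{p+1}{6}\Big]+4\tfrac{p'-1}{6}>0.$$ All of these numbers ($pp'(2n+1)\pm4\frac{p+1}{6}$ and the two displayed quantities, for $n\ge0$) are common non-ranks of $p$ and $p'$.
   Context: For real $x$, $N(x)$ is the integer nearest to $x$. For a prime $q\geq 5$, the non-ranks of $q$ are the integers $(2n+1)q+4N(q/6)$ with $n\geq 0$ and $(2n+1)q-4N(q/6)$ with $n\geq 1$. A common non-rank of $p$ and $p'$ is an integer that is a non-rank of $p$ and a non-rank of $p'$. -}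

module Defs where

open import Data.Nat as ℕ using (ℕ; _≤_)
open import Data.Integer using (ℤ; +_; _+_; _-_; _*_)
open import Data.Rational using (ℚ; _/_; round)
open import Data.Product using (∃; _×_)
open import Data.Sum using (_⊎_)
open import Relation.Binary.PropositionalEquality using (_≡_)

N : ℚ → ℤ
N = round

NonRank : ℕ → ℤ → Set
NonRank q m =
  (∃ λ (n : ℕ) → m ≡ (+ (2 ℕ.* n ℕ.+ 1)) * + q + + 4 * N (+ q / 6))
  ⊎ (∃ λ (n : ℕ) → 1 ≤ n × m ≡ (+ (2 ℕ.* n ℕ.+ 1)) * + q - + 4 * N (+ q / 6))

CommonNonRank : ℕ → ℕ → ℤ → Set
CommonNonRank p p′ m = NonRank p m × NonRank p′ m

-- Twin primes p, p + 2 ≥ 5 force p ≡ 5 (mod 6); write p = 6m + 5, p′ = p + 2 and k = 2n + 1.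
-- Then (p + 1)/6 = (p′ − 1)/6 = m + 1 =: c, and N(p/6) = N(p′/6) = c as well: for x = p, p′,
-- x/6 + ½ = t/3 with t = (x + 3)/2 prime to 3, so the floor is read off the normal form t/3.
-- Hence a number is a non-rank of q ∈ {p, p′} once it is u·q + 4c, or u·q − 4c with u ≥ 3,
-- for an odd u. For pp′k ± 4c take u = p′k (q = p) and u = pk (q = p′). For p(p′k ± 4c) ± 4c
-- take u = p′k ± 4c (q = p) and, since 4c·p ± 4c = 4c·p′ ∓ 4c, u = pk ± 4c (q = p′).
-- Non-ranks of p are positive because 4c < 3p.
module Submission where

open import Defs
open import Data.Nat as ℕ using (ℕ; _≤_; _∸_)
open import Data.Nat.Primality using (Prime)
open import Data.Integer using (ℤ; +_; _+_; _-_; _*_; _<_)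
open import Data.Product using (_×_)
open import Relation.Binary.PropositionalEquality using (_≡_)

open import Algebra.Properties.CommutativeSemigroup using (xy∙z≈y∙xz)
open import Data.Bool.Base using (true; false; T)
open import Data.Empty using (⊥-elim)
open import Data.Integer.Base using (+<+)
open import Data.Integer.DivMod using (div-pos-is-/ℕ)
import Data.Integer.Properties as ℤ
open import Data.Integer.Tactic.RingSolver using (solve-∀)
open import Data.List.Base using ([]; _∷_)
open import Data.Nat.Coprimality using (Coprime; coprime?)
open import Data.Nat.DivMod using (m%n<n; m≡m%n+[m/n]*n; %-distribˡ-+; +-distrib-/-∣ˡ; m*n/n≡m; m<n⇒m/n≡0)
open import Data.Nat.Divisibility using (_∣_; _∤_; divides; ∣n∣m%n⇒∣m; ∣m+n∣m⇒∣n; n∣m*n; ∣-trans)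
open import Data.Nat.Primality using (composite)
import Data.Nat.Properties as ℕ
import Data.Nat.Tactic.RingSolver as ℕ-Solver
open import Data.Product using (∃; _,_; proj₁; proj₂)
open import Data.Rational.Base as ℚ using (toℚᵘ; fromℚᵘ; ½; 0ℚ; floor; round; Positive)
open import Data.Rational.Properties
  using (toℚᵘ-injective; toℚᵘ-homo-+; toℚᵘ-fromℚᵘ; fromℚᵘ-cong; normalize-coprime; normalize-pos;
         positive⁻¹; ≤ᵇ⇒≤; <-≤-trans; <-irrefl)
import Data.Rational.Unnormalised.Base as ℚᵘ
import Data.Rational.Unnormalised.Properties as ℚᵘ
open import Data.Sum using (inj₁; inj₂)
open import Data.Unit.Base using (tt)
open import Relation.Nullary.Decidable using (from-yes)
open import Relation.Nullary.Negation using (contradiction)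
open import Relation.Binary.PropositionalEquality using (refl; sym; trans; cong; cong₂; subst; subst₂; module ≡-Reasoning)

fromℚᵘ-homo-+ : ∀ p q → fromℚᵘ (p ℚᵘ.+ q) ≡ fromℚᵘ p ℚ.+ fromℚᵘ q
fromℚᵘ-homo-+ p q = toℚᵘ-injective (begin-equality
  toℚᵘ (fromℚᵘ (p ℚᵘ.+ q))              ≃⟨ toℚᵘ-fromℚᵘ (p ℚᵘ.+ q) ⟩
  p ℚᵘ.+ q                               ≃⟨ ℚᵘ.+-cong (toℚᵘ-fromℚᵘ p) (toℚᵘ-fromℚᵘ q) ⟨
  toℚᵘ (fromℚᵘ p) ℚᵘ.+ toℚᵘ (fromℚᵘ q)  ≃⟨ toℚᵘ-homo-+ (fromℚᵘ p) (fromℚᵘ q) ⟨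
  toℚᵘ (fromℚᵘ p ℚ.+ fromℚᵘ q)           ∎)
  where open ℚᵘ.≤-Reasoning

pos⇒round≡floor[p+½] : ∀ p → .{{_ : Positive p}} → round p ≡ floor (p ℚ.+ ½)
pos⇒round≡floor[p+½] p with p ℚ.≤ᵇ 0ℚ in p≤ᵇ0
... | false = refl
... | true  = contradiction (<-≤-trans (positive⁻¹ p) (≤ᵇ⇒≤ (subst T (sym p≤ᵇ0) tt))) (<-irrefl refl)

coprime⇒floor[t/d]≡t/d : ∀ t d → Coprime t (ℕ.suc d) → floor (+ t ℚ./ ℕ.suc d) ≡ + (t ℕ./ ℕ.suc d)
coprime⇒floor[t/d]≡t/d t d t⊥d = trans (cong floor (normalize-coprime t⊥d)) (div-pos-is-/ℕ (+ t) (ℕ.suc d))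

a/6+½≡t/3 : ∀ a t → a ℕ.+ 3 ≡ 2 ℕ.* t → + a ℚ./ 6 ℚ.+ ½ ≡ + t ℚ./ 3
a/6+½≡t/3 a t a+3≡2t = trans (sym (fromℚᵘ-homo-+ (ℚᵘ.mkℚᵘ (+ a) 5) ℚᵘ.½))
  (fromℚᵘ-cong {ℚᵘ.mkℚᵘ (+ a) 5 ℚᵘ.+ ℚᵘ.½} {ℚᵘ.mkℚᵘ (+ t) 2} (ℚᵘ.*≡* (begin
    (+ a * + 2 + + 1 * + 6) * + 3 ≡⟨ lhs (+ a) ⟩
    + 6 * (+ a + + 3)             ≡⟨ cong (+ 6 *_) (trans (cong +_ a+3≡2t) (ℤ.pos-* 2 t)) ⟩
    + 6 * (+ 2 * + t)             ≡⟨ rhs (+ t) ⟩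
    + t * (+ 6 * + 2)             ∎)))
  where
  open ≡-Reasoning
  lhs : ∀ A → (A * + 2 + + 1 * + 6) * + 3 ≡ + 6 * (A + + 3)
  lhs = solve-∀
  rhs : ∀ T → + 6 * (+ 2 * T) ≡ T * (+ 6 * + 2)
  rhs = solve-∀

round[a/6]≡t/3 : ∀ a t .{{_ : ℕ.NonZero a}} → a ℕ.+ 3 ≡ 2 ℕ.* t → Coprime t 3 → round (+ a ℚ./ 6) ≡ + (t ℕ./ 3)
round[a/6]≡t/3 a t a+3≡2t t⊥3 = begin
  round (+ a ℚ./ 6)         ≡⟨ pos⇒round≡floor[p+½] (+ a ℚ./ 6) {{normalize-pos a 6}} ⟩
  floor (+ a ℚ./ 6 ℚ.+ ½)   ≡⟨ cong floor (a/6+½≡t/3 a t a+3≡2t) ⟩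
  floor (+ t ℚ./ 3)         ≡⟨ coprime⇒floor[t/d]≡t/d t 2 t⊥3 ⟩
  + (t ℕ./ 3)               ∎
  where open ≡-Reasoning

coprime-*+ : ∀ {r n} k → Coprime r n → Coprime (k ℕ.* n ℕ.+ r) n
coprime-*+ k r⊥n (d∣kn+r , d∣n) = r⊥n (∣m+n∣m⇒∣n d∣kn+r (∣-trans d∣n (n∣m*n k)) , d∣n)

[m*n+r]/n≡m : ∀ m {n r} .{{_ : ℕ.NonZero n}} → r ℕ.< n → (m ℕ.* n ℕ.+ r) ℕ./ n ≡ m
[m*n+r]/n≡m m {n} {r} r<n = begin
  (m ℕ.* n ℕ.+ r) ℕ./ n       ≡⟨ +-distrib-/-∣ˡ r (n∣m*n m) ⟩
  m ℕ.* n ℕ./ n ℕ.+ r ℕ./ n   ≡⟨ cong₂ ℕ._+_ (m*n/n≡m m n) (m<n⇒m/n≡0 r<n) ⟩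
  m ℕ.+ 0                     ≡⟨ ℕ.+-identityʳ m ⟩
  m                           ∎
  where open ≡-Reasoning

N[[6m+5]/6]≡1+m : ∀ m → N (+ (6 ℕ.* m ℕ.+ 5) ℚ./ 6) ≡ + ℕ.suc m
N[[6m+5]/6]≡1+m m =
  trans (round[a/6]≡t/3 (6 ℕ.* m ℕ.+ 5) (ℕ.suc m ℕ.* 3 ℕ.+ 1) {{ℕ.≢-nonZero (ℕ.m+1+n≢0 (6 ℕ.* m))}}
                     (ℕ-Solver.solve (m ∷ [])) (coprime-*+ (ℕ.suc m) (from-yes (coprime? 1 3))))
        (cong +_ ([m*n+r]/n≡m (ℕ.suc m) {3} (ℕ.s≤s (ℕ.s≤s ℕ.z≤n))))

N[[6m+7]/6]≡1+m : ∀ m → N (+ (6 ℕ.* m ℕ.+ 5 ℕ.+ 2) ℚ./ 6) ≡ + ℕ.suc m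
N[[6m+7]/6]≡1+m m =
  trans (round[a/6]≡t/3 (6 ℕ.* m ℕ.+ 5 ℕ.+ 2) (ℕ.suc m ℕ.* 3 ℕ.+ 2) {{ℕ.≢-nonZero (ℕ.m+1+n≢0 (6 ℕ.* m ℕ.+ 5))}}
                     (ℕ-Solver.solve (m ∷ [])) (coprime-*+ (ℕ.suc m) (from-yes (coprime? 2 3))))
        (cong +_ ([m*n+r]/n≡m (ℕ.suc m) {3} (ℕ.s≤s (ℕ.s≤s (ℕ.s≤s ℕ.z≤n)))))

prime∧<⇒∤ : ∀ {p d} .{{_ : ℕ.NonTrivial d}} → Prime p → d ℕ.< p → d ∤ p
prime∧<⇒∤ p-prime d<p d∣p = Prime.notComposite p-prime (composite d<p d∣p)

∣-by-residue : ∀ {d n r} → d ∣ 6 → n ℕ.% 6 ≡ r → d ∣ r → d ∣ n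
∣-by-residue d∣6 refl d∣r = ∣n∣m%n⇒∣m d∣6 d∣r

twin-prime-residue : ∀ {p} → Prime p → 5 ≤ p → Prime (p ℕ.+ 2) → p ℕ.% 6 ≡ 5
twin-prime-residue {p} p-prime 5≤p p+2-prime = residue (p ℕ.% 6) refl (m%n<n p 6)
  where
  2<p : 2 ℕ.< p
  2<p = ℕ.≤-trans (ℕ.s≤s (ℕ.s≤s (ℕ.s≤s ℕ.z≤n))) 5≤p
  3<p : 3 ℕ.< p
  3<p = ℕ.≤-trans (ℕ.s≤s (ℕ.s≤s (ℕ.s≤s (ℕ.s≤s ℕ.z≤n)))) 5≤p
  residue : ∀ r → p ℕ.% 6 ≡ r → r ℕ.< 6 → r ≡ 5
  residue 0 p%6≡0 _ = ⊥-elim (prime∧<⇒∤ p-prime 2<p (∣-by-residue (divides 3 refl) p%6≡0 (divides 0 refl)))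
  residue 1 p%6≡1 _ = ⊥-elim (prime∧<⇒∤ p+2-prime (ℕ.≤-trans 3<p (ℕ.m≤m+n p 2))
    (∣-by-residue (divides 2 refl) (trans (%-distribˡ-+ p 2 6) (cong (λ r → (r ℕ.+ 2) ℕ.% 6) p%6≡1)) (divides 1 refl)))
  residue 2 p%6≡2 _ = ⊥-elim (prime∧<⇒∤ p-prime 2<p (∣-by-residue (divides 3 refl) p%6≡2 (divides 1 refl)))
  residue 3 p%6≡3 _ = ⊥-elim (prime∧<⇒∤ p-prime 3<p (∣-by-residue (divides 2 refl) p%6≡3 (divides 1 refl)))
  residue 4 p%6≡4 _ = ⊥-elim (prime∧<⇒∤ p-prime 2<p (∣-by-residue (divides 3 refl) p%6≡4 (divides 2 refl)))
  residue 5 _ _ = refl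
  residue (ℕ.suc (ℕ.suc (ℕ.suc (ℕ.suc (ℕ.suc (ℕ.suc _)))))) _ (ℕ.s≤s (ℕ.s≤s (ℕ.s≤s (ℕ.s≤s (ℕ.s≤s (ℕ.s≤s ()))))))

twin-prime-form : ∀ {p} → Prime p → 5 ≤ p → Prime (p ℕ.+ 2) → ∃ λ m → p ≡ 6 ℕ.* m ℕ.+ 5
twin-prime-form {p} p-prime 5≤p p+2-prime = p ℕ./ 6 , (begin
  p                             ≡⟨ m≡m%n+[m/n]*n p 6 ⟩
  p ℕ.% 6 ℕ.+ p ℕ./ 6 ℕ.* 6     ≡⟨ cong (ℕ._+ p ℕ./ 6 ℕ.* 6) (twin-prime-residue p-prime 5≤p p+2-prime) ⟩
  5 ℕ.+ p ℕ./ 6 ℕ.* 6           ≡⟨ ℕ.+-comm 5 (p ℕ./ 6 ℕ.* 6) ⟩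
  p ℕ./ 6 ℕ.* 6 ℕ.+ 5           ≡⟨ cong (ℕ._+ 5) (ℕ.*-comm (p ℕ./ 6) 6) ⟩
  6 ℕ.* (p ℕ./ 6) ℕ.+ 5         ∎)
  where open ≡-Reasoning

[6m+5+1]/6≡1+m : ∀ m → (6 ℕ.* m ℕ.+ 5 ℕ.+ 1) ℕ./ 6 ≡ ℕ.suc m
[6m+5+1]/6≡1+m m = trans (cong (ℕ._/ 6) 6m+5+1≡[1+m]*6) (m*n/n≡m (ℕ.suc m) 6)
  where
  6m+5+1≡[1+m]*6 : 6 ℕ.* m ℕ.+ 5 ℕ.+ 1 ≡ ℕ.suc m ℕ.* 6
  6m+5+1≡[1+m]*6 = ℕ-Solver.solve (m ∷ [])

[6m+5+2∸1]/6≡1+m : ∀ m → (6 ℕ.* m ℕ.+ 5 ℕ.+ 2 ∸ 1) ℕ./ 6 ≡ ℕ.suc m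
[6m+5+2∸1]/6≡1+m m = trans (cong (ℕ._/ 6) (ℕ.+-∸-assoc (6 ℕ.* m ℕ.+ 5) (ℕ.s≤s ℕ.z≤n))) ([6m+5+1]/6≡1+m m)

nonRank⁺ : ∀ {q c x} j {U} → N (+ q ℚ./ 6) ≡ + c → + (2 ℕ.* j ℕ.+ 1) ≡ U →
           x ≡ + q * U + + 4 * + c → NonRank q x
nonRank⁺ {q} j {U} N≡c 2j+1≡U x≡ =
  inj₁ (j , trans x≡ (cong₂ (λ u v → u + + 4 * v) (trans (ℤ.*-comm (+ q) U) (cong (_* + q) (sym 2j+1≡U))) (sym N≡c)))

nonRank⁻ : ∀ {q c x} j {U} → 1 ≤ j → N (+ q ℚ./ 6) ≡ + c → + (2 ℕ.* j ℕ.+ 1) ≡ U →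
           x ≡ + q * U - + 4 * + c → NonRank q x
nonRank⁻ {q} j {U} 1≤j N≡c 2j+1≡U x≡ =
  inj₂ (j , 1≤j , trans x≡ (cong₂ (λ u v → u - + 4 * v) (trans (ℤ.*-comm (+ q) U) (cong (_* + q) (sym 2j+1≡U))) (sym N≡c)))

n<m⇒0<[+m]-[+n] : ∀ {m n} → n ℕ.< m → + 0 < + m - + n
n<m⇒0<[+m]-[+n] {m} {n} n<m =
  subst (+ 0 <_) (sym (trans (ℤ.[+m]-[+n]≡m⊖n m n) (ℤ.⊖-≥ (ℕ.<⇒≤ n<m)))) (+<+ (ℕ.m<n⇒0<n∸m n<m))

nonRank⇒positive : ∀ {q c x} → N (+ q ℚ./ 6) ≡ + c → 4 ℕ.* c ℕ.< 3 ℕ.* q → NonRank q x → + 0 < x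
nonRank⇒positive {q} {c} N≡c 4c<3q (inj₁ (j , refl)) rewrite N≡c =
  subst (+ 0 <_) (cong₂ _+_ (ℤ.pos-* (2 ℕ.* j ℕ.+ 1) q) (ℤ.pos-* 4 c)) (+<+ 0<[2j+1]q+4c)
  where
  instance _ = ℕ.≢-nonZero (ℕ.m+1+n≢0 (2 ℕ.* j) {0})
  0<[2j+1]q+4c : 0 ℕ.< (2 ℕ.* j ℕ.+ 1) ℕ.* q ℕ.+ 4 ℕ.* c
  0<[2j+1]q+4c = ℕ.<-≤-trans (ℕ.*-cancelˡ-< 3 0 q (ℕ.m<n⇒0<n 4c<3q))
                   (ℕ.≤-trans (ℕ.m≤n*m q (2 ℕ.* j ℕ.+ 1)) (ℕ.m≤m+n _ _))
nonRank⇒positive {q} {c} N≡c 4c<3q (inj₂ (j , 1≤j , refl)) rewrite N≡c =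
  subst (+ 0 <_) (cong₂ _-_ (ℤ.pos-* (2 ℕ.* j ℕ.+ 1) q) (ℤ.pos-* 4 c)) (n<m⇒0<[+m]-[+n] 4c<[2j+1]q)
  where
  4c<[2j+1]q : 4 ℕ.* c ℕ.< (2 ℕ.* j ℕ.+ 1) ℕ.* q
  4c<[2j+1]q = ℕ.<-≤-trans 4c<3q (ℕ.*-monoˡ-≤ q (ℕ.+-monoˡ-≤ 1 (ℕ.*-monoʳ-≤ 2 1≤j)))

pos-*-≡ : ∀ {j} a b → j ≡ a ℕ.* b → + j ≡ + a * + b
pos-*-≡ a b j≡ab = trans (cong +_ j≡ab) (ℤ.pos-* a b)

pos-*+-≡ : ∀ {j} a b d → j ≡ a ℕ.* b ℕ.+ 4 ℕ.* d → + j ≡ + a * + b + + 4 * + d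
pos-*+-≡ a b d j≡ab+4d = trans (cong +_ j≡ab+4d) (cong₂ _+_ (ℤ.pos-* a b) (ℤ.pos-* 4 d))

pos-*∸-≡ : ∀ {j} a b d → j ℕ.+ 4 ℕ.* d ≡ a ℕ.* b → + j ≡ + a * + b - + 4 * + d
pos-*∸-≡ {j} a b d j+4d≡ab =
  trans (a≡a+b-b (+ j) (+ (4 ℕ.* d))) (cong₂ _-_ (pos-*-≡ a b j+4d≡ab) (ℤ.pos-* 4 d))
  where
  a≡a+b-b : ∀ A B → A ≡ A + B - B
  a≡a+b-b = solve-∀

twin-identity⁺ : ∀ P K C → P * ((P + + 2) * K + + 4 * C) + + 4 * C ≡ (P + + 2) * (P * K + + 4 * C) - + 4 * C
twin-identity⁺ = solve-∀

twin-identity⁻ : ∀ P K C → P * ((P + + 2) * K - + 4 * C) - + 4 * C ≡ (P + + 2) * (P * K - + 4 * C) + + 4 * C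
twin-identity⁻ = solve-∀

odd-cofactor : ∀ c e n {q} → 2 ℕ.* (2 ℕ.* c ℕ.+ e) ℕ.+ 1 ≡ q →
               2 ℕ.* (2 ℕ.* c ℕ.+ e ℕ.+ n ℕ.* q) ℕ.+ 1 ≡ q ℕ.* (2 ℕ.* n ℕ.+ 1)
odd-cofactor c e n refl = ℕ-Solver.solve (c ∷ e ∷ n ∷ [])

odd-cofactor+4c : ∀ c e n {q} → 2 ℕ.* (2 ℕ.* c ℕ.+ e) ℕ.+ 1 ≡ q →
                  2 ℕ.* (4 ℕ.* c ℕ.+ e ℕ.+ n ℕ.* q) ℕ.+ 1 ≡ q ℕ.* (2 ℕ.* n ℕ.+ 1) ℕ.+ 4 ℕ.* c
odd-cofactor+4c c e n refl = ℕ-Solver.solve (c ∷ e ∷ n ∷ [])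

odd-cofactor∸4c : ∀ c e n {q} → 2 ℕ.* (2 ℕ.* c ℕ.+ e) ℕ.+ 1 ≡ q →
                  2 ℕ.* (e ℕ.+ n ℕ.* q) ℕ.+ 1 ℕ.+ 4 ℕ.* c ≡ q ℕ.* (2 ℕ.* n ℕ.+ 1)
odd-cofactor∸4c c e n refl = ℕ-Solver.solve (c ∷ e ∷ n ∷ [])

6m+5-odd : ∀ m → 2 ℕ.* (2 ℕ.* ℕ.suc m ℕ.+ m) ℕ.+ 1 ≡ 6 ℕ.* m ℕ.+ 5
6m+5-odd = ℕ-Solver.solve-∀

6m+7-odd : ∀ m → 2 ℕ.* (2 ℕ.* ℕ.suc m ℕ.+ ℕ.suc m) ℕ.+ 1 ≡ 6 ℕ.* m ℕ.+ 5 ℕ.+ 2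
6m+7-odd = ℕ-Solver.solve-∀

4[1+m]<3[6m+5] : ∀ m → 4 ℕ.* ℕ.suc m ℕ.< 3 ℕ.* (6 ℕ.* m ℕ.+ 5)
4[1+m]<3[6m+5] m = ℕ.≤-trans (ℕ.m≤m+n (ℕ.suc (4 ℕ.* ℕ.suc m)) (14 ℕ.* m ℕ.+ 10)) (ℕ.≤-reflexive identity)
  where
  identity : ℕ.suc (4 ℕ.* ℕ.suc m) ℕ.+ (14 ℕ.* m ℕ.+ 10) ≡ 3 ℕ.* (6 ℕ.* m ℕ.+ 5)
  identity = ℕ-Solver.solve (m ∷ [])

-- The conclusion of theorem3p8 with (p + 1)/6 and ((p + 2) ∸ 1)/6 abstracted as c and c′,
-- so that p = 6m + 5 and both quotients = m + 1 can be substituted with subst.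
TwinConclusion : (p n c c′ : ℕ) → Set
TwinConclusion p n c c′ =
  let P = + p
      P′ = + (p ℕ.+ 2)
      k = + (2 ℕ.* n ℕ.+ 1)
      a₊ = P * P′ * k + + 4 * + c
      a₋ = P * P′ * k - + 4 * + c
      b₊ = P * (P′ * k + + 4 * + c) + + 4 * + c
      b₋ = P * (P′ * k - + 4 * + c) - + 4 * + c
  in (+ 0 < a₊) × (+ 0 < a₋)
     × (b₊ ≡ P′ * (P * k + + 4 * + c) - + 4 * + c′) × (+ 0 < b₊)
     × (b₋ ≡ P′ * (P * k - + 4 * + c) + + 4 * + c′) × (+ 0 < b₋)
     × CommonNonRank p (p ℕ.+ 2) a₊ × CommonNonRank p (p ℕ.+ 2) a₋
     × CommonNonRank p (p ℕ.+ 2) b₊ × CommonNonRank p (p ℕ.+ 2) b₋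

module _ (m n : ℕ) where
  private
    p p′ k c : ℕ
    p  = 6 ℕ.* m ℕ.+ 5
    p′ = p ℕ.+ 2
    k  = 2 ℕ.* n ℕ.+ 1
    c  = ℕ.suc m

    N[p/6]≡c : N (+ p ℚ./ 6) ≡ + c
    N[p/6]≡c = N[[6m+5]/6]≡1+m m

    N[p′/6]≡c : N (+ p′ ℚ./ 6) ≡ + c
    N[p′/6]≡c = N[[6m+7]/6]≡1+m m

    p-odd : 2 ℕ.* (2 ℕ.* c ℕ.+ m) ℕ.+ 1 ≡ p
    p-odd = 6m+5-odd m

    p′-odd : 2 ℕ.* (2 ℕ.* c ℕ.+ c) ℕ.+ 1 ≡ p′
    p′-odd = 6m+7-odd m

  a₊-common : CommonNonRank p p′ (+ p * + p′ * + k + + 4 * + c)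
  a₊-common =
      nonRank⁺ (2 ℕ.* c ℕ.+ c ℕ.+ n ℕ.* p′) N[p/6]≡c (pos-*-≡ p′ k (odd-cofactor c c n p′-odd))
        (cong (_+ + 4 * + c) (ℤ.*-assoc (+ p) (+ p′) (+ k)))
    , nonRank⁺ (2 ℕ.* c ℕ.+ m ℕ.+ n ℕ.* p) N[p′/6]≡c (pos-*-≡ p k (odd-cofactor c m n p-odd))
        (cong (_+ + 4 * + c) (xy∙z≈y∙xz ℤ.*-commutativeSemigroup (+ p) (+ p′) (+ k)))

  a₋-common : CommonNonRank p p′ (+ p * + p′ * + k - + 4 * + c)
  a₋-common =
      nonRank⁻ (2 ℕ.* c ℕ.+ c ℕ.+ n ℕ.* p′) (ℕ.s≤s ℕ.z≤n) N[p/6]≡c (pos-*-≡ p′ k (odd-cofactor c c n p′-odd))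
        (cong (_- + 4 * + c) (ℤ.*-assoc (+ p) (+ p′) (+ k)))
    , nonRank⁻ (2 ℕ.* c ℕ.+ m ℕ.+ n ℕ.* p) (ℕ.s≤s ℕ.z≤n) N[p′/6]≡c (pos-*-≡ p k (odd-cofactor c m n p-odd))
        (cong (_- + 4 * + c) (xy∙z≈y∙xz ℤ.*-commutativeSemigroup (+ p) (+ p′) (+ k)))

  b₊-common : CommonNonRank p p′ (+ p * (+ p′ * + k + + 4 * + c) + + 4 * + c)
  b₊-common =
      nonRank⁺ (4 ℕ.* c ℕ.+ c ℕ.+ n ℕ.* p′) N[p/6]≡c (pos-*+-≡ p′ k c (odd-cofactor+4c c c n p′-odd)) refl
    , nonRank⁻ (4 ℕ.* c ℕ.+ m ℕ.+ n ℕ.* p) (ℕ.s≤s ℕ.z≤n) N[p′/6]≡c (pos-*+-≡ p k c (odd-cofactor+4c c m n p-odd))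
        (twin-identity⁺ (+ p) (+ k) (+ c))

  b₋-common : CommonNonRank p p′ (+ p * (+ p′ * + k - + 4 * + c) - + 4 * + c)
  b₋-common =
      nonRank⁻ (c ℕ.+ n ℕ.* p′) (ℕ.s≤s ℕ.z≤n) N[p/6]≡c (pos-*∸-≡ p′ k c (odd-cofactor∸4c c c n p′-odd)) refl
    , nonRank⁺ (m ℕ.+ n ℕ.* p) N[p′/6]≡c (pos-*∸-≡ p k c (odd-cofactor∸4c c m n p-odd))
        (twin-identity⁻ (+ p) (+ k) (+ c))

  twin-conclusion : TwinConclusion p n c c
  twin-conclusion =
      positive (proj₁ a₊-common) , positive (proj₁ a₋-common)
    , twin-identity⁺ (+ p) (+ k) (+ c) , positive (proj₁ b₊-common)
    , twin-identity⁻ (+ p) (+ k) (+ c) , positive (proj₁ b₋-common)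
    , a₊-common , a₋-common , b₊-common , b₋-common
    where
    positive : ∀ {x} → NonRank p x → + 0 < x
    positive = nonRank⇒positive N[p/6]≡c (4[1+m]<3[6m+5] m)

theorem3p8 : ∀ (p : ℕ) → Prime p → 5 ≤ p → Prime (p ℕ.+ 2) →
  ∀ (n : ℕ) →
    let p′ = p ℕ.+ 2
        P = + p
        P′ = + p′
        k = + (2 ℕ.* n ℕ.+ 1)
        c = + ((p ℕ.+ 1) ℕ./ 6)
        c′ = + ((p′ ∸ 1) ℕ./ 6)
        a₊ = P * P′ * k + + 4 * c
        a₋ = P * P′ * k - + 4 * c
        b₊ = P * (P′ * k + + 4 * c) + + 4 * c
        b₋ = P * (P′ * k - + 4 * c) - + 4 * c
    in (+ 0 < a₊) × (+ 0 < a₋)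
       × (b₊ ≡ P′ * (P * k + + 4 * c) - + 4 * c′) × (+ 0 < b₊)
       × (b₋ ≡ P′ * (P * k - + 4 * c) + + 4 * c′) × (+ 0 < b₋)
       × CommonNonRank p p′ a₊ × CommonNonRank p p′ a₋
       × CommonNonRank p p′ b₊ × CommonNonRank p p′ b₋
theorem3p8 p p-prime 5≤p p+2-prime n =
  subst (λ q → TwinConclusion q n ((q ℕ.+ 1) ℕ./ 6) ((q ℕ.+ 2 ∸ 1) ℕ./ 6)) (sym p≡6m+5)
    (subst₂ (TwinConclusion (6 ℕ.* m ℕ.+ 5) n) (sym ([6m+5+1]/6≡1+m m)) (sym ([6m+5+2∸1]/6≡1+m m))
      (twin-conclusion m n))
  where
  m : ℕ
  m = proj₁ (twin-prime-form p-prime 5≤p p+2-prime)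
  p≡6m+5 : p ≡ 6 ℕ.* m ℕ.+ 5
  p≡6m+5 = proj₂ (twin-prime-form p-prime 5≤p p+2-prime)
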